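{- Let $m\geqslant3$, let $\alpha=2\uparrow\uparrow(m-1)$, and let $n$ be a positive integer with $n<3^\alpha$. Then $H(n)=m$ if and only if $n=2^\alpha a$ for some odd integer $a<1.5^\alpha$. Moreover, if $n$ is not of the form $2^\alpha a$ with $a$ odd, then $H(n)\leqslant m-1$.
   Context: For a positive integer $n$ the height $H(n)$ is defined recursively. Set $H(1)=0$. If $n>1$ has canonical factorization $n=p_1^{a_1}\cdots p_k^{a_k}$ (distinct primes, $a_i\geqslant1$), set $H(n)=1+\max_iH(a_i)$. Tetration: $a\uparrow\uparrow0=1$ and $a\uparrow\uparrow(b+1)=a^{a\uparrow\uparrow b}$. -}

module Defs where

open import Data.Nat using (ℕ; zero; suc; _+_; _*_; _^_; _⊔_; _≤?_)
open import Data.Nat.Divisibility using (_∣?_)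
open import Data.Nat.Primality using (prime?)
open import Data.Nat.DivMod using (_/_)
open import Data.List using (List; foldr; upTo; filter; map)
open import Relation.Nullary using (yes; no)
open import Relation.Nullary.Decidable using (⌊_⌋)
open import Data.Bool using (if_then_else_)

_↑↑_ : ℕ → ℕ → ℕ
a ↑↑ zero = 1
a ↑↑ suc b = a ^ (a ↑↑ b)

-- p-adic valuation of n (for p ≥ 2, n ≥ 1), computed with fuel
valF : ℕ → ℕ → ℕ → ℕ
valF zero p n = 0
valF (suc f) zero n = 0
valF (suc f) (suc zero) n = 0
valF (suc f) (suc (suc q)) zero = 0
valF (suc f) (suc (suc q)) (suc m) with suc (suc q) ∣? suc m
... | yes _ = suc (valF f (suc (suc q)) (suc m / suc (suc q)))
... | no _ = 0

val : ℕ → ℕ → ℕ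
val p n = valF n p n

exponents : ℕ → List ℕ
exponents n =
  map (λ p → val p n)
      (filter (λ p → prime? p) (filter (λ p → p ∣? n) (upTo (suc n))))

HF : ℕ → ℕ → ℕ
HF zero n = 0
HF (suc f) n with n ≤? 1
... | yes _ = 0
... | no _ = suc (foldr (λ a r → HF f a ⊔ r) 0 (exponents n))

-- height of a positive integer (every exponent a_i satisfies a_i < n,
-- so fuel n suffices)
H : ℕ → ℕ
H n = HF n n

-- Write T j for 2 ↑↑ j. Every exponent v of k satisfies 2 ^ v ≤ k, so by induction on j every
-- k < T (j + 1) has H k ≤ j. Conversely, if H x > b + 1 then some prime p divides x exactly to a
-- power v with H v > b, hence v ≥ T (b + 1), and if moreover x < 3 ^ T (b + 1) then p = 2.
-- Let α = T (m - 1) and n < 3 ^ α ≤ 2 ^ 2 ^ α = T (m + 1), so H n ≤ m. If H n = m, the 2-adic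
-- exponent v of n has H v ≥ m - 1 and v < 2 α, because 2 ^ v ≤ n < 3 ^ α ≤ 4 ^ α. Applying the
-- same argument to v, its 2-adic exponent w satisfies T (m - 2) ≤ w and 2 ^ w ≤ v < 2 · 2 ^ T (m - 2),
-- so 2 ^ T (m - 2) = α divides v and v < 2 α, forcing v = α. Conversely H (2 ^ t · odd) > H t and
-- H (T i) ≥ i give H (2 ^ α · odd) ≥ m.
module Submission where

open import Data.List using (List; foldr; map; filter; upTo)
open import Data.List.Membership.Propositional using (_∈_)
open import Data.List.Membership.Propositional.Properties
  using (∈-map⁺; ∈-map⁻; ∈-filter⁺; ∈-filter⁻; ∈-upTo⁺; foldr-selective)
open import Data.List.Properties using (foldr-map; map-cong-local; foldr-preservesᵇ; foldr-preservesᵒ)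
open import Data.List.Relation.Unary.All as All using (All)
import Data.List.Relation.Unary.Any as Any
open import Data.Nat
open import Data.Nat.DivMod using (_/_; m/n*n≡m; m/n<m; m≥n⇒m/n>0)
open import Data.Nat.Divisibility
open import Data.Nat.Primality using (Prime; prime?; prime[2]; prime⇒nonTrivial)
open import Data.Nat.Properties
open import Data.Product using (Σ; _×_; _,_; proj₁; proj₂)
open import Data.Sum using (_⊎_; inj₁; inj₂; [_,_]′)
open import Function using (_∘_)
open import Function.Bundles using (_⇔_; mk⇔)
open import Relation.Binary.PropositionalEquality
open import Relation.Nullary using (¬_; yes; no; contradiction)

open import Defs

2^m<2^n⇒m<n : ∀ {m n} → 2 ^ m < 2 ^ n → m < n
2^m<2^n⇒m<n 2ᵐ<2ⁿ = ≰⇒> λ n≤m → <⇒≱ 2ᵐ<2ⁿ (^-monoʳ-≤ 2 n≤m)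

n<2^n : ∀ n → n < 2 ^ n
n<2^n zero = z<s
n<2^n (suc n) = +-mono-≤-< (m^n>0 2 n) (<-≤-trans (n<2^n n) (m≤m+n (2 ^ n) 0))

2*n≤2^n : ∀ n → 2 * n ≤ 2 ^ n
2*n≤2^n zero = z≤n
2*n≤2^n (suc n) = *-monoʳ-≤ 2 (n<2^n n)

2*2^n≤3^n : ∀ {n} → 2 ≤ n → 2 * 2 ^ n ≤ 3 ^ n
2*2^n≤3^n {suc zero} (s≤s ())
2*2^n≤3^n {suc (suc zero)} _ = n≤1+n 8
2*2^n≤3^n {suc (suc (suc n))} _ =
  ≤-trans (*-monoʳ-≤ 2 (2*2^n≤3^n {suc (suc n)} (s≤s (s≤s z≤n)))) (*-monoˡ-≤ (3 ^ (2 + n)) (n≤1+n 2))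

3^n≤2^[2*n] : ∀ n → 3 ^ n ≤ 2 ^ (2 * n)
3^n≤2^[2*n] n = ≤-trans (^-monoˡ-≤ n (n≤1+n 3)) (≤-reflexive (^-*-assoc 2 2 n))

3^n≤2^2^n : ∀ n → 3 ^ n ≤ 2 ^ (2 ^ n)
3^n≤2^2^n n = ≤-trans (3^n≤2^[2*n] n) (^-monoʳ-≤ 2 (2*n≤2^n n))

^-monoʳ-∣ : ∀ p {m n} → m ≤ n → p ^ m ∣ p ^ n
^-monoʳ-∣ p {m} {n} m≤n = divides (p ^ (n ∸ m)) (begin
  p ^ n                ≡⟨ cong (p ^_) (sym (m+[n∸m]≡n m≤n)) ⟩
  p ^ (m + (n ∸ m))    ≡⟨ ^-distribˡ-+-* p m (n ∸ m) ⟩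
  p ^ m * p ^ (n ∸ m)  ≡⟨ *-comm (p ^ m) (p ^ (n ∸ m)) ⟩
  p ^ (n ∸ m) * p ^ m  ∎)
  where open ≡-Reasoning

∣∧<2*⇒≡ : ∀ {m n} → m ∣ n → 1 ≤ n → n < 2 * m → n ≡ m
∣∧<2*⇒≡ {m} (divides zero refl) ()
∣∧<2*⇒≡ {m} (divides (suc zero) n≡m) _ _ = trans n≡m (*-identityˡ m)
∣∧<2*⇒≡ {m} (divides (suc (suc c)) n≡[2+c]*m) _ n<2m =
  contradiction (subst (2 * m ≤_) (sym n≡[2+c]*m) (*-monoˡ-≤ m (s≤s (s≤s (z≤n {c}))))) (<⇒≱ n<2m)

2∤2a+1 : ∀ a → ¬ (2 ∣ 2 * a + 1)
2∤2a+1 a 2∣2a+1 with () ← ∣1⇒≡1 (∣m+n∣m⇒∣n 2∣2a+1 (m∣m*n a))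

even⊎odd : ∀ c → (Σ ℕ λ d → c ≡ 2 * d) ⊎ (Σ ℕ λ a → c ≡ 2 * a + 1)
even⊎odd zero = inj₁ (0 , refl)
even⊎odd (suc c) with even⊎odd c
... | inj₁ (d , refl) = inj₂ (d , +-comm 1 (2 * d))
... | inj₂ (a , refl) = inj₁ (suc a , trans (cong suc (+-comm (2 * a) 1)) (sym (*-suc 2 a)))

prime⇒2≤ : ∀ {p} → Prime p → 2 ≤ p
prime⇒2≤ {p} pp = nonTrivial⇒n>1 p {{prime⇒nonTrivial pp}}

record ExactPower (p v n : ℕ) : Set where
  constructor exactPower
  field
    power∣ : p ^ v ∣ n
    suc-power∤ : ¬ (p ^ suc v ∣ n)

∤⇒ExactPower0 : ∀ {p n} → ¬ (p ∣ n) → ExactPower p 0 n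
∤⇒ExactPower0 {p} {n} p∤n = exactPower (1∣ n) (p∤n ∘ m*n∣⇒m∣ p 1)

ExactPower-*ˡ : ∀ {p v n} .{{_ : NonZero p}} → ExactPower p v n → ExactPower p (suc v) (p * n)
ExactPower-*ˡ {p} (exactPower pᵛ∣n pᵛ⁺¹∤n) = exactPower (*-monoʳ-∣ p pᵛ∣n) (pᵛ⁺¹∤n ∘ *-cancelˡ-∣ p)

ExactPower-unique : ∀ {p v w n} → ExactPower p v n → ExactPower p w n → v ≡ w
ExactPower-unique {p} (exactPower pᵛ∣n pᵛ⁺¹∤n) (exactPower pʷ∣n pʷ⁺¹∤n) = ≤-antisym
  (≮⇒≥ λ w<v → pʷ⁺¹∤n (∣-trans (^-monoʳ-∣ p w<v) pᵛ∣n))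
  (≮⇒≥ λ v<w → pᵛ⁺¹∤n (∣-trans (^-monoʳ-∣ p v<w) pʷ∣n))

ExactPower-2^t*odd : ∀ t a → ExactPower 2 t (2 ^ t * (2 * a + 1))
ExactPower-2^t*odd zero a = subst (ExactPower 2 0) (sym (*-identityˡ (2 * a + 1))) (∤⇒ExactPower0 (2∤2a+1 a))
ExactPower-2^t*odd (suc t) a =
  subst (ExactPower 2 (suc t)) (sym (*-assoc 2 (2 ^ t) (2 * a + 1))) (ExactPower-*ˡ (ExactPower-2^t*odd t a))

ExactPower⇒2^v*odd : ∀ {v n} → ExactPower 2 v n → Σ ℕ λ a → n ≡ 2 ^ v * (2 * a + 1)
ExactPower⇒2^v*odd {v} (exactPower (divides c n≡c*2ᵛ) 2ᵛ⁺¹∤n) with even⊎odd c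
... | inj₂ (a , refl) = a , trans n≡c*2ᵛ (*-comm (2 * a + 1) (2 ^ v))
... | inj₁ (d , refl) = contradiction 2ᵛ⁺¹∣n 2ᵛ⁺¹∤n
  where
  2ᵛ⁺¹∣n : 2 ^ suc v ∣ _
  2ᵛ⁺¹∣n = divides d (trans n≡c*2ᵛ (trans (cong (_* 2 ^ v) (*-comm 2 d)) (*-assoc d 2 (2 ^ v))))

valF-exact : ∀ f {p n} → 2 ≤ p → 1 ≤ n → n ≤ f → ExactPower p (valF f p n) n
valF-exact zero {n = suc _} _ _ ()
valF-exact (suc f) {suc zero} (s≤s ()) _ _
valF-exact (suc f) {p@(suc (suc _))} {n@(suc _)} 2≤p _ n≤1+f with p ∣? n
... | no p∤n = ∤⇒ExactPower0 p∤n
... | yes p∣n = subst (ExactPower p _) p*[n/p]≡n (ExactPower-*ˡ exact[n/p])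
  where
  p*[n/p]≡n : p * (n / p) ≡ n
  p*[n/p]≡n = trans (*-comm p (n / p)) (m/n*n≡m p∣n)
  exact[n/p] : ExactPower p (valF f p (n / p)) (n / p)
  exact[n/p] = valF-exact f 2≤p (m≥n⇒m/n>0 (∣⇒≤ p∣n)) (≤-pred (≤-trans (m/n<m n p 2≤p) n≤1+f))

val-exact : ∀ {p n} → 2 ≤ p → 1 ≤ n → ExactPower p (val p n) n
val-exact {n = n} 2≤p 1≤n = valF-exact n 2≤p 1≤n ≤-refl

val-pow≤ : ∀ {p n} → 2 ≤ p → 1 ≤ n → p ^ val p n ≤ n
val-pow≤ {n = suc _} 2≤p 1≤n = ∣⇒≤ (ExactPower.power∣ (val-exact 2≤p 1≤n))

2^val≤ : ∀ {p n} → 2 ≤ p → 1 ≤ n → 2 ^ val p n ≤ n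
2^val≤ {p} {n} 2≤p 1≤n = ≤-trans (^-monoˡ-≤ (val p n) 2≤p) (val-pow≤ 2≤p 1≤n)

val-< : ∀ {p n} → 2 ≤ p → 1 ≤ n → val p n < n
val-< {p} {n} 2≤p 1≤n = <-≤-trans (n<2^n (val p n)) (2^val≤ 2≤p 1≤n)

2^t*odd>0 : ∀ t a → 0 < 2 ^ t * (2 * a + 1)
2^t*odd>0 t a = *-mono-≤ (m^n>0 2 t) (m≤n+m 1 (2 * a))

val₂-2^t*odd : ∀ t a → val 2 (2 ^ t * (2 * a + 1)) ≡ t
val₂-2^t*odd t a = ExactPower-unique (val-exact ≤-refl (2^t*odd>0 t a)) (ExactPower-2^t*odd t a)

maximum : List ℕ → ℕ
maximum = foldr _⊔_ 0

∈⇒≤maximum : ∀ {x xs} → x ∈ xs → x ≤ maximum xs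
∈⇒≤maximum x∈ = foldr-preservesᵒ (λ y z → [ m≤n⇒m≤n⊔o z , m≤n⇒m≤o⊔n y ]′) 0 _ (inj₂ (Any.map ≤-reflexive x∈))

maximum≤ : ∀ {b xs} → All (_≤ b) xs → maximum xs ≤ b
maximum≤ = foldr-preservesᵇ ⊔-lub z≤n

maximum-∈ : ∀ {xs} → 0 < maximum xs → maximum xs ∈ xs
maximum-∈ {xs} 0<max with foldr-selective ⊔-sel 0 xs
... | inj₁ max≡0 = contradiction max≡0 (m<n⇒n≢0 0<max)
... | inj₂ max∈ = max∈

∈-exponents⁻ : ∀ {a n} → a ∈ exponents n → Σ ℕ λ p → Prime p × p ∣ n × a ≡ val p n
∈-exponents⁻ {n = n} a∈
  with p , p∈ , refl ← ∈-map⁻ (λ q → val q n) a∈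
  with p∈∣ , pp ← ∈-filter⁻ (λ q → prime? q) {xs = filter (λ q → q ∣? n) (upTo (suc n))} p∈
  with _ , p∣n ← ∈-filter⁻ (λ q → q ∣? n) {xs = upTo (suc n)} p∈∣
  = p , pp , p∣n , refl

∈-exponents⁺ : ∀ {p n} → 1 ≤ n → Prime p → p ∣ n → val p n ∈ exponents n
∈-exponents⁺ {p} {n@(suc _)} _ pp p∣n = ∈-map⁺ (λ q → val q n)
  (∈-filter⁺ (λ q → prime? q) (∈-filter⁺ (λ q → q ∣? n) (∈-upTo⁺ (s≤s (∣⇒≤ p∣n))) p∣n) pp)

exponents-< : ∀ {n} → 1 ≤ n → All (_< n) (exponents n)
exponents-< {n} 1≤n = All.tabulate λ a∈ →
  let p , pp , _ , a≡val = ∈-exponents⁻ {n = n} a∈ in subst (_< n) (sym a≡val) (val-< (prime⇒2≤ pp) 1≤n)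

HF-≤1 : ∀ f {n} → n ≤ 1 → HF f n ≡ 0
HF-≤1 zero _ = refl
HF-≤1 (suc f) {n} n≤1 with n ≤? 1
... | yes _ = refl
... | no n≰1 = contradiction n≤1 n≰1

HF-suc : ∀ f {n} → 2 ≤ n → HF (suc f) n ≡ suc (maximum (map (HF f) (exponents n)))
HF-suc f {n} 2≤n with n ≤? 1
... | yes n≤1 = contradiction n≤1 (<⇒≱ 2≤n)
... | no _ = cong suc (sym (foldr-map _⊔_ (HF f) 0 (exponents n)))

HF-fuel : ∀ f g {a} → a ≤ f → a ≤ g → HF f a ≡ HF g a
HF-fuel zero g z≤n _ = sym (HF-≤1 g z≤n)
HF-fuel (suc f) zero _ z≤n = HF-≤1 (suc f) z≤n
HF-fuel (suc f) (suc g) {a} a≤1+f a≤1+g with ≤-<-connex a 1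
... | inj₁ a≤1 = trans (HF-≤1 (suc f) a≤1) (sym (HF-≤1 (suc g) a≤1))
... | inj₂ 2≤a = begin
  HF (suc f) a                              ≡⟨ HF-suc f 2≤a ⟩
  suc (maximum (map (HF f) (exponents a)))  ≡⟨ cong (suc ∘ maximum) (map-cong-local fuels-agree) ⟩
  suc (maximum (map (HF g) (exponents a)))  ≡⟨ sym (HF-suc g 2≤a) ⟩
  HF (suc g) a                              ∎
  where
  open ≡-Reasoning
  fuels-agree : All (λ x → HF f x ≡ HF g x) (exponents a)
  fuels-agree = All.map (λ x<a → HF-fuel f g (≤-pred (≤-trans x<a a≤1+f)) (≤-pred (≤-trans x<a a≤1+g)))
                        (exponents-< (<⇒≤ 2≤a))

H-unfold : ∀ {n} → 2 ≤ n → H n ≡ suc (maximum (map H (exponents n)))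
H-unfold {n@(suc f)} 2≤n = trans (HF-suc f 2≤n) (cong (suc ∘ maximum) (map-cong-local
  (All.map (λ a<n → HF-fuel f _ (≤-pred a<n) ≤-refl) (exponents-< (<⇒≤ 2≤n)))))

H-≤1 : ∀ {n} → n ≤ 1 → H n ≡ 0
H-≤1 {n} = HF-≤1 n

H-bounded : ∀ {n b} → (∀ {p} → Prime p → p ∣ n → H (val p n) ≤ b) → H n ≤ suc b
H-bounded {n} {b} bound with ≤-<-connex n 1
... | inj₁ n≤1 = subst (_≤ suc b) (sym (H-≤1 n≤1)) z≤n
... | inj₂ 2≤n = subst (_≤ suc b) (sym (H-unfold 2≤n)) (s≤s (maximum≤ (All.tabulate heights≤b)))
  where
  heights≤b : ∀ {y} → y ∈ map H (exponents n) → y ≤ b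
  heights≤b y∈
    with a , a∈ , refl ← ∈-map⁻ H y∈
    with p , pp , p∣n , refl ← ∈-exponents⁻ {n = n} a∈
    = bound pp p∣n

H-val<H : ∀ {p n} → Prime p → p ∣ n → 1 ≤ n → H (val p n) < H n
H-val<H {p} {n@(suc _)} pp p∣n 1≤n = subst (H (val p n) <_) (sym (H-unfold 2≤n))
  (s≤s (∈⇒≤maximum (∈-map⁺ H (∈-exponents⁺ 1≤n pp p∣n))))
  where
  2≤n : 2 ≤ n
  2≤n = ≤-trans (prime⇒2≤ pp) (∣⇒≤ p∣n)

H-witness : ∀ {n b} → suc b < H n → Σ ℕ λ p → Prime p × p ∣ n × b < H (val p n)
H-witness {n} {b} 1+b<H with ≤-<-connex n 1
... | inj₁ n≤1 = contradiction (H-≤1 n≤1) (m<n⇒n≢0 1+b<H)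
... | inj₂ 2≤n = witness (≤-pred (subst (suc b <_) (H-unfold 2≤n) 1+b<H))
  where
  witness : b < maximum (map H (exponents n)) → Σ ℕ λ p → Prime p × p ∣ n × b < H (val p n)
  witness b<max
    with a , a∈ , max≡Ha ← ∈-map⁻ H (maximum-∈ (≤-<-trans z≤n b<max))
    with p , pp , p∣n , refl ← ∈-exponents⁻ {n = n} a∈
    = p , pp , p∣n , subst (b <_) max≡Ha b<max

2↑↑n>0 : ∀ n → 0 < 2 ↑↑ n
2↑↑n>0 zero = z<s
2↑↑n>0 (suc n) = m^n>0 2 (2 ↑↑ n)

<2↑↑[1+j]⇒H≤j : ∀ j {k} → k < 2 ↑↑ suc j → H k ≤ j
<2↑↑[1+j]⇒H≤j zero k<2 = ≤-reflexive (H-≤1 (≤-pred k<2))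
<2↑↑[1+j]⇒H≤j (suc j) {zero} _ = z≤n
<2↑↑[1+j]⇒H≤j (suc j) {k@(suc _)} k<2↑↑[2+j] = H-bounded λ {p} pp _ →
  <2↑↑[1+j]⇒H≤j j {val p k} (2^m<2^n⇒m<n (≤-<-trans (2^val≤ {n = k} (prime⇒2≤ pp) z<s) k<2↑↑[2+j]))

H>j⇒2↑↑[1+j]≤ : ∀ j {k} → j < H k → 2 ↑↑ suc j ≤ k
H>j⇒2↑↑[1+j]≤ j j<H = ≮⇒≥ λ k<2↑↑ → <⇒≱ j<H (<2↑↑[1+j]⇒H≤j j k<2↑↑)

val₂-of-high-height : ∀ b {x} → x < 3 ^ (2 ↑↑ suc b) → suc b < H x → 2 ↑↑ suc b ≤ val 2 x × b < H (val 2 x)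
val₂-of-high-height b {x@(suc _)} x<3^T 1+b<H with H-witness 1+b<H
... | p , pp , _ , b<H[v] with p ≟ 2
...   | yes refl = H>j⇒2↑↑[1+j]≤ b b<H[v] , b<H[v]
...   | no p≢2 = contradiction x<3^T (≤⇒≯ (begin
        3 ^ (2 ↑↑ suc b)  ≤⟨ ^-monoʳ-≤ 3 (H>j⇒2↑↑[1+j]≤ b {val p x} b<H[v]) ⟩
        3 ^ val p x       ≤⟨ ^-monoˡ-≤ (val p x) (≤∧≢⇒< (prime⇒2≤ pp) (p≢2 ∘ sym)) ⟩
        p ^ val p x       ≤⟨ val-pow≤ (prime⇒2≤ pp) z<s ⟩
        x                 ∎))
  where open ≤-Reasoning

high-height⇒2↑↑ : ∀ j {v} → v < 2 * 2 ↑↑ suc (suc j) → suc j < H v → v ≡ 2 ↑↑ suc (suc j)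
high-height⇒2↑↑ j {v@(suc _)} v<2*2^T 1+j<H = ∣∧<2*⇒≡ 2^T∣v z<s v<2*2^T
  where
  T = 2 ↑↑ suc j
  T≤val₂v : T ≤ val 2 v
  T≤val₂v = proj₁ (val₂-of-high-height j (<-≤-trans v<2*2^T (2*2^n≤3^n (^-monoʳ-≤ 2 (2↑↑n>0 j)))) 1+j<H)
  val₂v≤T : val 2 v ≤ T
  val₂v≤T = ≤-pred (2^m<2^n⇒m<n (≤-<-trans (val-pow≤ ≤-refl z<s) v<2*2^T))
  2^T∣v : 2 ^ T ∣ v
  2^T∣v = subst (λ e → 2 ^ e ∣ v) (≤-antisym val₂v≤T T≤val₂v) (ExactPower.power∣ (val-exact ≤-refl z<s))

high-height⇒2^2↑↑*odd : ∀ j {x} → x < 3 ^ (2 ↑↑ suc (suc j)) → suc (suc j) < H x →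
  Σ ℕ λ a → x ≡ 2 ^ (2 ↑↑ suc (suc j)) * (2 * a + 1)
high-height⇒2^2↑↑*odd j {x@(suc _)} x<3^α 2+j<H =
  subst (λ e → Σ ℕ λ a → x ≡ 2 ^ e * (2 * a + 1)) val₂x≡α (ExactPower⇒2^v*odd (val-exact ≤-refl z<s))
  where
  α = 2 ↑↑ suc (suc j)
  val₂x<2α : val 2 x < 2 * α
  val₂x<2α = 2^m<2^n⇒m<n (≤-<-trans (val-pow≤ ≤-refl z<s) (<-≤-trans x<3^α (3^n≤2^[2*n] α)))
  val₂x≡α : val 2 x ≡ α
  val₂x≡α = high-height⇒2↑↑ j val₂x<2α (proj₂ (val₂-of-high-height (suc j) x<3^α 2+j<H))

H<H[2^t*odd] : ∀ {t} a → 1 ≤ t → H t < H (2 ^ t * (2 * a + 1))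
H<H[2^t*odd] {t} a 1≤t = subst (λ e → H e < H (2 ^ t * (2 * a + 1))) (val₂-2^t*odd t a)
  (H-val<H prime[2] (∣-trans (^-monoʳ-∣ 2 1≤t) (m∣m*n (2 * a + 1))) (2^t*odd>0 t a))

n≤H[2↑↑n] : ∀ n → n ≤ H (2 ↑↑ n)
n≤H[2↑↑n] zero = z≤n
n≤H[2↑↑n] (suc n) = subst (λ e → suc n ≤ H e) (*-identityʳ (2 ↑↑ suc n))
  (≤-trans (s≤s (n≤H[2↑↑n] n)) (H<H[2^t*odd] 0 (2↑↑n>0 n)))

lemma3 : (m : ℕ) → 3 ≤ m → (n : ℕ) → 1 ≤ n → n < 3 ^ (2 ↑↑ (m ∸ 1)) →
    ((H n ≡ m) ⇔ (Σ ℕ λ a → (n ≡ 2 ^ (2 ↑↑ (m ∸ 1)) * (2 * a + 1)) × (2 ^ (2 ↑↑ (m ∸ 1)) * (2 * a + 1) < 3 ^ (2 ↑↑ (m ∸ 1)))))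
    × (¬ (Σ ℕ λ a → n ≡ 2 ^ (2 ↑↑ (m ∸ 1)) * (2 * a + 1)) → H n ≤ m ∸ 1)
lemma3 (suc zero) (s≤s ())
lemma3 (suc (suc zero)) (s≤s (s≤s ()))
lemma3 m@(suc (suc (suc j))) _ n _ n<3^α = mk⇔ to from , not-of-form⇒H≤m-1
  where
  α = 2 ↑↑ suc (suc j)
  H≤m : H n ≤ m
  H≤m = <2↑↑[1+j]⇒H≤j m (<-≤-trans n<3^α (3^n≤2^2^n α))
  to : H n ≡ m → Σ ℕ λ a → (n ≡ 2 ^ α * (2 * a + 1)) × (2 ^ α * (2 * a + 1) < 3 ^ α)
  to Hn≡m with a , n≡ ← high-height⇒2^2↑↑*odd j n<3^α (≤-reflexive (sym Hn≡m)) = a , n≡ , subst (_< 3 ^ α) n≡ n<3^α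
  from : (Σ ℕ λ a → (n ≡ 2 ^ α * (2 * a + 1)) × (2 ^ α * (2 * a + 1) < 3 ^ α)) → H n ≡ m
  from (a , refl , _) = ≤-antisym H≤m (≤-trans (s≤s (n≤H[2↑↑n] (suc (suc j)))) (H<H[2^t*odd] a (2↑↑n>0 (suc (suc j)))))
  not-of-form⇒H≤m-1 : ¬ (Σ ℕ λ a → n ≡ 2 ^ α * (2 * a + 1)) → H n ≤ suc (suc j)
  not-of-form⇒H≤m-1 not-of-form with suc (suc j) <? H n
  ... | yes 2+j<H = contradiction (high-height⇒2^2↑↑*odd j n<3^α 2+j<H) not-of-form
  ... | no 2+j≮H = ≮⇒≥ 2+j≮H
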